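{- Let $d_9$ be the number of monotone Boolean functions of $9$ variables and let $\lambda_9$ be the number of self-dual monotone Boolean functions of $9$ variables. Then $d_9\equiv\lambda_9\equiv 0\pmod 2$.
   Context: $\{0,1\}^n$ carries the componentwise partial order, and a Boolean function $f:\{0,1\}^n\to\{0,1\}$ is monotone if $x\le y$ implies $f(x)\le f(y)$. The dual of a Boolean function $f$ is $f^d(x_1,\dots,x_n)=1-f(1-x_1,\dots,1-x_n)$ (equivalently, in the truth-table bit string, reverse the order of the bits and negate each bit); $f$ is self-dual if $f=f^d$. The dual of a monotone function is monotone. -}

module Defs where

open import Data.Bool using (Bool; true; false; not; _≤_)
open import Data.Bool.Properties using (_≤?_) renaming (_≟_ to _≟ᵇ_)
open import Data.Nat using (ℕ; zero; suc)
open import Data.Product using (_×_; _,_; proj₁; proj₂)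
open import Data.Vec using (Vec; []; _∷_)
import Data.Vec as Vec
open import Data.List using (List; []; _∷_; filter; length; concatMap)
import Data.List as List
open import Data.Vec.Relation.Binary.Pointwise.Inductive using (Pointwise; decidable)
open import Relation.Nullary using (Dec; yes; no)
open import Relation.Nullary.Decidable using (_×-dec_; _→-dec_; map′)
open import Relation.Binary.PropositionalEquality using (_≡_)

Input : ℕ → Set
Input n = Vec Bool n

BoolFun : ℕ → Set
BoolFun n = Input n → Bool

_≤ᵢ_ : ∀ {n} → Input n → Input n → Set
x ≤ᵢ y = Pointwise _≤_ x y

Monotone : ∀ {n} → BoolFun n → Set
Monotone f = ∀ x y → x ≤ᵢ y → f x ≤ f y

dual : ∀ {n} → BoolFun n → BoolFun n
dual f x = not (f (Vec.map not x))

SelfDual : ∀ {n} → BoolFun n → Set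
SelfDual f = ∀ x → f x ≡ dual f x

-- Truth tables: a canonical finite representation of Boolean functions.
-- Table 0 is a bit; Table (suc n) is a pair (value table when x₁ = 0,
-- value table when x₁ = 1).
Table : ℕ → Set
Table zero = Bool
Table (suc n) = Table n × Table n

eval : ∀ {n} → Table n → BoolFun n
eval {zero} b [] = b
eval {suc n} (t₀ , t₁) (false ∷ x) = eval t₀ x
eval {suc n} (t₀ , t₁) (true ∷ x) = eval t₁ x

allTables : (n : ℕ) → List (Table n)
allTables zero = false ∷ true ∷ []
allTables (suc n) = concatMap (λ a → List.map (a ,_) (allTables n)) (allTables n)

∀? : ∀ {n} {P : Input n → Set} → (∀ x → Dec (P x)) → Dec (∀ x → P x)
∀? {zero} p? = map′ (λ { p [] → p }) (λ h → h []) (p? [])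
∀? {suc n} {P} p? =
  map′ (λ { (h₀ , h₁) (false ∷ x) → h₀ x ; (h₀ , h₁) (true ∷ x) → h₁ x })
       (λ h → (λ x → h (false ∷ x)) , (λ x → h (true ∷ x)))
       (∀? (λ x → p? (false ∷ x)) ×-dec ∀? (λ x → p? (true ∷ x)))

monotone? : ∀ {n} (f : BoolFun n) → Dec (Monotone f)
monotone? f = ∀? (λ x → ∀? (λ y → decidable _≤?_ x y →-dec (f x ≤? f y)))

selfDual? : ∀ {n} (f : BoolFun n) → Dec (SelfDual f)
selfDual? f = ∀? (λ x → f x ≟ᵇ dual f x)

d : ℕ → ℕ
d n = length (filter (λ t → monotone? (eval t)) (allTables n))

λsd : ℕ → ℕ
λsd n = length (filter (λ t → monotone? (eval t) ×-dec selfDual? (eval t)) (allTables n))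

-- Counting modulo 2, one may keep only the fixed points of any involution that preserves the
-- property being counted: the other elements pair up with their images. Duality is such an
-- involution on monotone functions, with the self-dual ones as fixed points, so d₉ ≡ λ₉.
-- A self-dual monotone function of nine variables is (f , fᵈ) with f monotone and f ≤ fᵈ,
-- so λ₉ counts these "intersecting" f of eight variables. Permutations of the variables
-- preserve this property; the dihedral group ⟨(1 2), (3 4), (1 3)(2 4)⟩ acting on the first
-- and on the last four variables leaves only functions invariant under both. Such a function
-- is given by six invariant monotone functions of four variables, one for each orbit of
-- {0,1}⁴, ordered like the orbits; there are few such tuples, and evaluating shows that an
-- even number of them is intersecting.

module Submission where

open import Algebra.Bundles using (CommutativeMonoid; CommutativeRing)
open import Algebra.Definitions using (Involutive)
open import Data.Bool using (Bool; true; false; not; _∧_; _∨_; _xor_; T; f≤t; b≤b)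
  renaming (_≤_ to _≤ᵇ_)
import Data.Bool.Properties as 𝔹
open import Data.Empty using (⊥-elim)
open import Data.Fin using (#_)
open import Data.List using (List; []; _∷_; _++_; map; concatMap; filter; filterᵇ; length)
open import Data.Nat using (ℕ; zero; suc; _+_; _%_)
open import Data.Nat.DivMod using ([m+n]%n≡m%n)
open import Data.Nat.Properties using (+-comm)
open import Data.Product using (_×_; _,_; proj₁; proj₂; ∃)
import Data.Product.Properties as ×
open import Data.Vec using ([]; _∷_) renaming (_++_ to _++ᵛ_)
open import Data.Vec.Relation.Binary.Pointwise.Inductive using ([]; _∷_; ++⁺)
  renaming (refl to ≤ᵢ-refl)
open import Function using (_∘_; Equivalence)
open import Relation.Binary.Definitions using (DecidableEquality)
open import Relation.Binary.PropositionalEquality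
open import Relation.Nullary using (Dec; yes; no; does)
open import Relation.Nullary.Decidable using (dec-true; dec-false; _×-dec_)

open import Defs

open import Algebra.Properties.CommutativeSemigroup
  (CommutativeRing.+-commutativeSemigroup 𝔹.xor-∧-commutativeRing)
  using () renaming (interchange to xor-interchange)
open import Algebra.Properties.CommutativeSemigroup
  (CommutativeMonoid.commutativeSemigroup 𝔹.∧-commutativeMonoid)
  using () renaming (interchange to ∧-interchange; xy∙z≈xz∙y to xy∧z≡xz∧y; x∙yz≈y∙xz to x∧yz≡y∧xz)

private variable
  A B W : Set
  m : ℕ

T-∧-intro : ∀ {x y} → T x → T y → T (x ∧ y)
T-∧-intro p q = Equivalence.from 𝔹.T-∧ (p , q)

T-∧-elimˡ : ∀ {x y} → T (x ∧ y) → T x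
T-∧-elimˡ = proj₁ ∘ Equivalence.to 𝔹.T-∧

T-∧-elimʳ : ∀ {x y} → T (x ∧ y) → T y
T-∧-elimʳ = proj₂ ∘ Equivalence.to 𝔹.T-∧

xor-cancel-middle : ∀ a b c → (a xor b) xor (b xor c) ≡ a xor c
xor-cancel-middle false false c = refl
xor-cancel-middle false true  c = 𝔹.not-involutive c
xor-cancel-middle true  false c = refl
xor-cancel-middle true  true  c = refl

∧-absorbs-repeat : ∀ x y → x ∧ (x ∧ y) ≡ x ∧ y
∧-absorbs-repeat x y = trans (sym (𝔹.∧-assoc x x y)) (cong (_∧ y) (𝔹.∧-idem x))

does-≡ : ∀ {P : Set} {b} (P? : Dec P) → (T b → P) → (P → T b) → does P? ≡ b
does-≡ {b = true}  P? from to = dec-true P? (from _)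
does-≡ {b = false} P? from to = dec-false P? to

does⇒ : ∀ {P : Set} (P? : Dec P) → T (does P?) → P
does⇒ (yes p) _ = p

⇒does : ∀ {P : Set} (P? : Dec P) → P → T (does P?)
⇒does P? p = subst T (sym (dec-true P? p)) _

does-≟-injective : (_≟_ : DecidableEquality A) (ι : A → A) → Involutive _≡_ ι →
                   ∀ a b → does (ι a ≟ ι b) ≡ does (a ≟ b)
does-≟-injective _≟_ ι ι-invol a b =
  does-≡ (ι a ≟ ι b) (cong ι ∘ does⇒ (a ≟ b)) (⇒does (a ≟ b) ∘ injective)
  where
    injective : ι a ≡ ι b → a ≡ b
    injective p = trans (sym (ι-invol a)) (trans (cong ι p) (ι-invol b))

-- Parity of a count

parity : (A → Bool) → List A → Bool
parity f []       = false
parity f (x ∷ xs) = f x xor parity f xs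

parity-cong : ∀ {f g : A → Bool} xs → (∀ x → f x ≡ g x) → parity f xs ≡ parity g xs
parity-cong []       f≗g = refl
parity-cong (x ∷ xs) f≗g = cong₂ _xor_ (f≗g x) (parity-cong xs f≗g)

parity-false : (xs : List A) → parity (λ _ → false) xs ≡ false
parity-false []       = refl
parity-false (x ∷ xs) = parity-false xs

parity-xor : ∀ (f g : A → Bool) xs →
             parity (λ x → f x xor g x) xs ≡ parity f xs xor parity g xs
parity-xor f g []       = refl
parity-xor f g (x ∷ xs) =
  trans (cong ((f x xor g x) xor_) (parity-xor f g xs)) (xor-interchange (f x) (g x) _ _)

parity-∧ˡ : ∀ c (f : A → Bool) xs → parity (λ x → c ∧ f x) xs ≡ c ∧ parity f xs
parity-∧ˡ true  f xs = refl
parity-∧ˡ false f xs = parity-false xs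

parity-++ : ∀ (f : A → Bool) xs ys → parity f (xs ++ ys) ≡ parity f xs xor parity f ys
parity-++ f []       ys = refl
parity-++ f (x ∷ xs) ys =
  trans (cong (f x xor_) (parity-++ f xs ys)) (sym (𝔹.xor-assoc (f x) _ _))

parity-map : ∀ (f : B → Bool) (h : A → B) xs → parity f (map h xs) ≡ parity (f ∘ h) xs
parity-map f h []       = refl
parity-map f h (x ∷ xs) = cong (f (h x) xor_) (parity-map f h xs)

parity-concatMap : ∀ (f : B → Bool) (h : A → List B) xs →
                   parity f (concatMap h xs) ≡ parity (parity f ∘ h) xs
parity-concatMap f h []       = refl
parity-concatMap f h (x ∷ xs) =
  trans (parity-++ f (h x) (concatMap h xs)) (cong (parity f (h x) xor_) (parity-concatMap f h xs))

parity-filterᵇ : ∀ (c f : A → Bool) xs → parity f (filterᵇ c xs) ≡ parity (λ x → c x ∧ f x) xs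
parity-filterᵇ c f []       = refl
parity-filterᵇ c f (x ∷ xs) with c x
... | true  = cong (f x xor_) (parity-filterᵇ c f xs)
... | false = parity-filterᵇ c f xs

filterᵇ-∧ : ∀ (c c′ : A → Bool) xs → filterᵇ (λ x → c x ∧ c′ x) xs ≡ filterᵇ c′ (filterᵇ c xs)
filterᵇ-∧ c c′ []       = refl
filterᵇ-∧ c c′ (x ∷ xs) with c x
... | false = filterᵇ-∧ c c′ xs
... | true with c′ x
...   | true  = cong (x ∷_) (filterᵇ-∧ c c′ xs)
...   | false = filterᵇ-∧ c c′ xs

parity-swap : ∀ (h : A → B → Bool) xs ys →
              parity (λ x → parity (h x) ys) xs ≡ parity (λ y → parity (λ x → h x y) xs) ys
parity-swap h []       ys = sym (parity-false ys)
parity-swap h (x ∷ xs) ys =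
  trans (cong (parity (h x) ys xor_) (parity-swap h xs ys)) (sym (parity-xor (h x) _ ys))

parity-diagonal : ∀ (h : A → A → Bool) → (∀ x y → h x y ≡ h y x) → ∀ xs →
                  parity (λ x → parity (h x) xs) xs ≡ parity (λ x → h x x) xs
parity-diagonal h h-sym []       = refl
parity-diagonal h h-sym (z ∷ xs) = begin
    (h z z xor parity (h z) xs) xor parity (λ x → h x z xor parity (h x) xs) xs
  ≡⟨ cong ((h z z xor parity (h z) xs) xor_) (parity-xor (λ x → h x z) (λ x → parity (h x) xs) xs) ⟩
    (h z z xor parity (h z) xs) xor (parity (λ x → h x z) xs xor parity (λ x → parity (h x) xs) xs)
  ≡⟨ cong (λ s → (h z z xor parity (h z) xs) xor (s xor parity (λ x → parity (h x) xs) xs))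
          (parity-cong xs (λ x → h-sym x z)) ⟩
    (h z z xor parity (h z) xs) xor (parity (h z) xs xor parity (λ x → parity (h x) xs) xs)
  ≡⟨ xor-cancel-middle (h z z) _ _ ⟩
    h z z xor parity (λ x → parity (h x) xs) xs
  ≡⟨ cong (h z z xor_) (parity-diagonal h h-sym xs) ⟩
    h z z xor parity (λ x → h x x) xs
  ∎
  where open ≡-Reasoning

parity-witness : ∀ (f : A → Bool) xs → T (parity f xs) → ∃ λ x → T (f x)
parity-witness f (x ∷ xs) odd with f x in fx
... | true  = x , subst T (sym fx) _
... | false = parity-witness f xs odd

parity-restrict : ∀ (f c : A → Bool) xs {xs′} → filterᵇ c xs ≡ xs′ →
                  (∀ x → T (f x) → T (c x)) → parity f xs ≡ parity f xs′
parity-restrict f c xs refl supp = trans (parity-cong xs absorb) (sym (parity-filterᵇ c f xs))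
  where
    absorb : ∀ x → f x ≡ c x ∧ f x
    absorb x with f x in fx
    ... | false = sym (𝔹.∧-zeroʳ (c x))
    ... | true  = sym (trans (𝔹.∧-identityʳ (c x))
                             (Equivalence.to 𝔹.T-≡ (supp x (subst T (sym fx) _))))

length-filter-%2 : ∀ {P : A → Set} (P? : ∀ x → Dec (P x)) xs →
          parity (does ∘ P?) xs ≡ false → length (filter P? xs) % 2 ≡ 0
length-filter-%2 P? xs even = go (length (filter P? xs)) (trans (odd-length xs) even)
  where
    odd : ℕ → Bool
    odd zero    = false
    odd (suc n) = not (odd n)

    odd-length : ∀ xs → odd (length (filter P? xs)) ≡ parity (does ∘ P?) xs
    odd-length []       = refl
    odd-length (x ∷ xs) with does (P? x)
    ... | true  = cong not (odd-length xs)
    ... | false = odd-length xs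

    go : ∀ n → odd n ≡ false → n % 2 ≡ 0
    go zero          _    = refl
    go (suc zero)    ()
    go (suc (suc n)) even =
      trans (trans (cong (_% 2) (+-comm 2 n)) ([m+n]%n≡m%n n 2))
            (go n (trans (sym (𝔹.not-involutive (odd n))) even))

-- Opaque, so that unification matches product lists structurally instead of unfolding them.
opaque
  infixr 5 _⋉_
  _⋉_ : List A → (A → List B) → List (A × B)
  xs ⋉ ys = concatMap (λ a → map (a ,_) (ys a)) xs

  parity-⋉ : ∀ (f : A × B → Bool) xs ys →
             parity f (xs ⋉ ys) ≡ parity (λ a → parity (λ b → f (a , b)) (ys a)) xs
  parity-⋉ f xs ys =
    trans (parity-concatMap f _ xs) (parity-cong xs (λ a → parity-map f (a ,_) (ys a)))

  allTables-suc : ∀ n → allTables (suc n) ≡ (allTables n ⋉ λ _ → allTables n)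
  allTables-suc n = refl

parity-⋉-restrict : ∀ {A B : Set} (f : A × B → Bool) (c : A → Bool) {xs xs′ ys zs} →
  filterᵇ c xs ≡ xs′ →
  (∀ a b → T (f (a , b)) → T (c a)) →
  (∀ a → parity (λ b → f (a , b)) (ys a) ≡ parity (λ b → f (a , b)) (zs a)) →
  parity f (xs ⋉ ys) ≡ parity f (xs′ ⋉ zs)
parity-⋉-restrict {A} {B} f c {xs} {xs′} {ys} {zs} filtered supp inner = begin
  parity f (xs ⋉ ys)                 ≡⟨ parity-⋉ f xs ys ⟩
  parity (fibre ys) xs               ≡⟨ parity-restrict (fibre ys) c xs filtered supp′ ⟩
  parity (fibre ys) xs′              ≡⟨ parity-cong xs′ inner ⟩
  parity (fibre zs) xs′              ≡⟨ parity-⋉ f xs′ zs ⟨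
  parity f (xs′ ⋉ zs)                ∎
  where
    open ≡-Reasoning
    fibre : (A → List B) → A → Bool
    fibre ys a = parity (λ b → f (a , b)) (ys a)
    supp′ : ∀ a → T (fibre ys a) → T (c a)
    supp′ a odd = let b , fab = parity-witness _ (ys a) odd in supp a b fab

-- xs lists every element of A an odd number of times.
record IsEnumeration {A : Set} (_≟_ : DecidableEquality A) (xs : List A) : Set where
  field
    parity-point : ∀ z (g : A → Bool) → parity (λ y → does (y ≟ z) ∧ g y) xs ≡ g z

open IsEnumeration

module _ {_≟_ : DecidableEquality A} {xs : List A} (enum : IsEnumeration _≟_ xs) where

  parity-supported : ∀ (g : A → Bool) z → (∀ y → T (g y) → y ≡ z) → parity g xs ≡ g z
  parity-supported g z supp = trans (parity-cong xs localise) (parity-point enum z g)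
    where
      localise : ∀ y → g y ≡ does (y ≟ z) ∧ g y
      localise y with g y in gy
      ... | false = sym (𝔹.∧-zeroʳ _)
      ... | true with supp y (subst T (sym gy) _)
      ...   | refl = sym (cong (_∧ true) (dec-true (y ≟ y) refl))

  -- Points moved by ι pair up with their images, so only fixed points contribute.
  parity-involution : (ι : A → A) → Involutive _≡_ ι → (f : A → Bool) → (∀ t → f (ι t) ≡ f t) →
                      parity f xs ≡ parity (λ t → f t ∧ does (ι t ≟ t)) xs
  parity-involution ι ι-invol f f-ι = begin
      parity f xs
    ≡⟨ parity-cong xs split ⟩
      parity (λ t → fixedPart t xor movedPart t) xs
    ≡⟨ parity-xor fixedPart movedPart xs ⟩
      parity fixedPart xs xor parity movedPart xs
    ≡⟨ cong (parity fixedPart xs xor_) moved-cancel ⟩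
      parity fixedPart xs xor false
    ≡⟨ 𝔹.xor-identityʳ _ ⟩
      parity fixedPart xs
    ∎
    where
      open ≡-Reasoning
      fixedPart movedPart : A → Bool
      fixedPart t = f t ∧ does (ι t ≟ t)
      movedPart t = f t ∧ not (does (ι t ≟ t))

      split : ∀ t → f t ≡ fixedPart t xor movedPart t
      split t with f t | does (ι t ≟ t)
      ... | false | _     = refl
      ... | true  | true  = refl
      ... | true  | false = refl

      movedPart-ι : ∀ t → movedPart (ι t) ≡ movedPart t
      movedPart-ι t = cong₂ (λ u v → u ∧ not v) (f-ι t) (does-≟-injective _≟_ ι ι-invol (ι t) t)

      pair : A → A → Bool
      pair t y = does (y ≟ ι t) ∧ movedPart t

      pair-sym : ∀ t y → pair t y ≡ pair y t
      pair-sym t y with y ≟ ι t | t ≟ ι y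
      ... | yes refl | yes _     = sym (movedPart-ι t)
      ... | yes refl | no t≢ιιt  = ⊥-elim (t≢ιιt (sym (ι-invol t)))
      ... | no y≢ιt  | yes refl  = ⊥-elim (y≢ιt (sym (ι-invol y)))
      ... | no _     | no _      = refl

      pair-diagonal : ∀ t → pair t t ≡ false
      pair-diagonal t with t ≟ ι t
      ... | no _     = refl
      ... | yes t≡ιt rewrite dec-true (ι t ≟ t) (sym t≡ιt) = 𝔹.∧-zeroʳ (f t)

      moved-cancel : parity movedPart xs ≡ false
      moved-cancel = begin
          parity movedPart xs
        ≡⟨ parity-cong xs (λ t → sym (parity-point enum (ι t) (λ _ → movedPart t))) ⟩
          parity (λ t → parity (pair t) xs) xs
        ≡⟨ parity-diagonal pair pair-sym xs ⟩
          parity (λ t → pair t t) xs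
        ≡⟨ parity-cong xs pair-diagonal ⟩
          parity (λ _ → false) xs
        ≡⟨ parity-false xs ⟩
          false
        ∎

×-isEnumeration : ∀ {_≟A_ : DecidableEquality A} {_≟B_ : DecidableEquality B} {as bs} →
  IsEnumeration _≟A_ as → IsEnumeration _≟B_ bs → IsEnumeration (×.≡-dec _≟A_ _≟B_) (as ⋉ λ _ → bs)
×-isEnumeration {A = A} {B = B} {_≟A_} {_≟B_} {as} {bs} enumA enumB .parity-point (z₁ , z₂) g =
  begin
    parity (λ y → does (y ≟× (z₁ , z₂)) ∧ g y) (as ⋉ λ _ → bs)
  ≡⟨ parity-⋉ _ as (λ _ → bs) ⟩
    parity (λ a → parity (λ b → does ((a , b) ≟× (z₁ , z₂)) ∧ g (a , b)) bs) as
  ≡⟨ parity-cong as (λ a → parity-cong bs (λ b → cong (_∧ g (a , b)) (does-≟× a b))) ⟩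
    parity (λ a → parity (λ b → (does (a ≟A z₁) ∧ does (b ≟B z₂)) ∧ g (a , b)) bs) as
  ≡⟨ parity-cong as (λ a → trans (parity-cong bs (λ b → 𝔹.∧-assoc (does (a ≟A z₁)) _ _))
                                  (parity-∧ˡ (does (a ≟A z₁)) _ bs)) ⟩
    parity (λ a → does (a ≟A z₁) ∧ parity (λ b → does (b ≟B z₂) ∧ g (a , b)) bs) as
  ≡⟨ parity-cong as (λ a → cong (does (a ≟A z₁) ∧_) (parity-point enumB z₂ (λ b → g (a , b)))) ⟩
    parity (λ a → does (a ≟A z₁) ∧ g (a , z₂)) as
  ≡⟨ parity-point enumA z₁ (λ a → g (a , z₂)) ⟩
    g (z₁ , z₂)
  ∎
  where
    open ≡-Reasoning
    _≟×_ : DecidableEquality (A × B)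
    _≟×_ = ×.≡-dec _≟A_ _≟B_
    does-≟× : ∀ a b → does ((a , b) ≟× (z₁ , z₂)) ≡ does (a ≟A z₁) ∧ does (b ≟B z₂)
    does-≟× a b = does-≡ ((a , b) ≟× (z₁ , z₂))
      (λ both → cong₂ _,_ (does⇒ (a ≟A z₁) (T-∧-elimˡ both))
                          (does⇒ (b ≟B z₂) (T-∧-elimʳ both)))
      (λ ab≡z → T-∧-intro (⇒does (a ≟A z₁) (×.,-injectiveˡ ab≡z))
                          (⇒does (b ≟B z₂) (×.,-injectiveʳ ab≡z)))

parity-section : ∀ {_≟A_ : DecidableEquality A} {_≟W_ : DecidableEquality W} {as ws} →
  IsEnumeration _≟A_ as → IsEnumeration _≟W_ ws → (φ : W → A) (ψ : A → W) →
  (∀ w → ψ (φ w) ≡ w) → (g : A → Bool) → (∀ a → T (g a) → a ≡ φ (ψ a)) →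
  parity g as ≡ parity (λ w → g (φ w)) ws
parity-section {_≟W_ = _≟W_} {as} {ws} enumA enumW φ ψ ψ∘φ g supp = begin
    parity g as
  ≡⟨ parity-cong as (λ a → sym (parity-point enumW (ψ a) (λ _ → g a))) ⟩
    parity (λ a → parity (λ w → does (w ≟W ψ a) ∧ g a) ws) as
  ≡⟨ parity-swap (λ a w → does (w ≟W ψ a) ∧ g a) as ws ⟩
    parity (λ w → parity (λ a → does (w ≟W ψ a) ∧ g a) as) ws
  ≡⟨ parity-cong ws (λ w → parity-supported enumA _ (φ w) (fibre-supp w)) ⟩
    parity (λ w → does (w ≟W ψ (φ w)) ∧ g (φ w)) ws
  ≡⟨ parity-cong ws (λ w → cong (_∧ g (φ w)) (dec-true (w ≟W ψ (φ w)) (sym (ψ∘φ w)))) ⟩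
    parity (λ w → g (φ w)) ws
  ∎
  where
    open ≡-Reasoning
    fibre-supp : ∀ w a → T (does (w ≟W ψ a) ∧ g a) → a ≡ φ w
    fibre-supp w a h = trans (supp a (T-∧-elimʳ h)) (cong φ (sym (does⇒ (w ≟W ψ a) (T-∧-elimˡ h))))

-- Fixed points of the dihedral group of order 8

record IsD4 {A : Set} (σ₁ σ₂ β : A → A) : Set where
  field
    σ₁-involutive : Involutive _≡_ σ₁
    σ₂-involutive : Involutive _≡_ σ₂
    β-involutive  : Involutive _≡_ β
    σ₁σ₂≡σ₂σ₁     : ∀ t → σ₁ (σ₂ t) ≡ σ₂ (σ₁ t)
    σ₁β≡βσ₂       : ∀ t → σ₁ (β t) ≡ β (σ₂ t)
    σ₂β≡βσ₁       : ∀ t → σ₂ (β t) ≡ β (σ₁ t)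

module _ (_≟_ : DecidableEquality A) where

  fixedBy : (A → A) → A → Bool
  fixedBy ι t = does (ι t ≟ t)

  fixedBy-conjugate : (j ι j′ : A → A) → Involutive _≡_ ι → (∀ t → j (ι t) ≡ ι (j′ t)) →
                      ∀ t → fixedBy j (ι t) ≡ fixedBy j′ t
  fixedBy-conjugate j ι j′ ι-invol j∘ι t =
    trans (cong (λ u → does (u ≟ ι t)) (j∘ι t)) (does-≟-injective _≟_ ι ι-invol (j′ t) t)

  fixedBy₃ : (σ₁ σ₂ β : A → A) → A → Bool
  fixedBy₃ σ₁ σ₂ β t = (fixedBy σ₁ t ∧ fixedBy σ₂ t) ∧ fixedBy β t

  fixedBy₃⇒ : ∀ σ₁ σ₂ β t → T (fixedBy₃ σ₁ σ₂ β t) → σ₁ t ≡ t × σ₂ t ≡ t × β t ≡ t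
  fixedBy₃⇒ σ₁ σ₂ β t fixed =
    let fixed₁₂ , fixedβ = Equivalence.to (𝔹.T-∧ {fixedBy σ₁ t ∧ fixedBy σ₂ t}) fixed
        fixed₁  , fixed₂ = Equivalence.to (𝔹.T-∧ {fixedBy σ₁ t}) fixed₁₂
    in does⇒ (σ₁ t ≟ t) fixed₁ , does⇒ (σ₂ t ≟ t) fixed₂ , does⇒ (β t ≟ t) fixedβ

  ⇒fixedBy₃ : ∀ σ₁ σ₂ β t → σ₁ t ≡ t → σ₂ t ≡ t → β t ≡ t → T (fixedBy₃ σ₁ σ₂ β t)
  ⇒fixedBy₃ σ₁ σ₂ β t σ₁t≡t σ₂t≡t βt≡t =
    T-∧-intro (T-∧-intro (⇒does (σ₁ t ≟ t) σ₁t≡t) (⇒does (σ₂ t ≟ t) σ₂t≡t)) (⇒does (β t ≟ t) βt≡t)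

parity-D4-fixed : ∀ {A : Set} {_≟_ : DecidableEquality A} {xs} {σ₁ σ₂ β : A → A} →
  IsEnumeration _≟_ xs → IsD4 σ₁ σ₂ β → (f : A → Bool) →
  (∀ t → f (σ₁ t) ≡ f t) → (∀ t → f (σ₂ t) ≡ f t) → (∀ t → f (β t) ≡ f t) →
  parity f xs ≡ parity (λ t → f t ∧ fixedBy₃ _≟_ σ₁ σ₂ β t) xs
parity-D4-fixed {A} {_≟_} {xs} {σ₁} {σ₂} {β} enum D f f-σ₁ f-σ₂ f-β = begin
    parity f xs
  ≡⟨ parity-involution enum σ₁ σ₁-involutive f f-σ₁ ⟩
    parity f₁ xs
  ≡⟨ parity-involution enum σ₂ σ₂-involutive f₁ f₁-σ₂ ⟩
    parity f₂ xs
  ≡⟨ parity-involution enum β β-involutive f₂ f₂-β ⟩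
    parity (λ t → f₂ t ∧ fixedBy _≟_ β t) xs
  ≡⟨ parity-cong xs (λ t → trans (𝔹.∧-assoc (f t ∧ _) _ _) (𝔹.∧-assoc (f t) _ _)) ⟩
    parity (λ t → f t ∧ (fixedBy _≟_ σ₁ t ∧ (fixedBy _≟_ σ₂ t ∧ fixedBy _≟_ β t))) xs
  ≡⟨ parity-cong xs (λ t → cong (f t ∧_) (sym (𝔹.∧-assoc (fixedBy _≟_ σ₁ t) _ _))) ⟩
    parity (λ t → f t ∧ fixedBy₃ _≟_ σ₁ σ₂ β t) xs
  ∎
  where
    open ≡-Reasoning
    open IsD4 D
    f₁ f₂ : A → Bool
    f₁ t = f t ∧ fixedBy _≟_ σ₁ t
    f₂ t = f₁ t ∧ fixedBy _≟_ σ₂ t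
    f₁-σ₂ : ∀ t → f₁ (σ₂ t) ≡ f₁ t
    f₁-σ₂ t = cong₂ _∧_ (f-σ₂ t) (fixedBy-conjugate _≟_ σ₁ σ₂ σ₁ σ₂-involutive σ₁σ₂≡σ₂σ₁ t)
    f₂-β : ∀ t → f₂ (β t) ≡ f₂ t
    f₂-β t = trans (cong₂ (λ u v → (f (β t) ∧ u) ∧ v)
                          (fixedBy-conjugate _≟_ σ₁ β σ₂ β-involutive σ₁β≡βσ₂ t)
                          (fixedBy-conjugate _≟_ σ₂ β σ₁ β-involutive σ₂β≡βσ₁ t))
                   (trans (cong (λ u → (u ∧ _) ∧ _) (f-β t)) (xy∧z≡xz∧y (f t) _ _))

-- Truth tables as Boolean data

_≟ᵀ_ : ∀ {n} → DecidableEquality (Table n)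
_≟ᵀ_ {zero}  = 𝔹._≟_
_≟ᵀ_ {suc n} = ×.≡-dec _≟ᵀ_ _≟ᵀ_

allTables-isEnumeration : ∀ n → IsEnumeration (_≟ᵀ_ {n}) (allTables n)
allTables-isEnumeration zero    .parity-point true  g = 𝔹.xor-identityʳ (g true)
allTables-isEnumeration zero    .parity-point false g = 𝔹.xor-identityʳ (g false)
allTables-isEnumeration (suc n) = subst (IsEnumeration _≟ᵀ_) (sym (allTables-suc n))
  (×-isEnumeration (allTables-isEnumeration n) (allTables-isEnumeration n))

infix 4 _≤ᵀ_
_≤ᵀ_ : ∀ {n} → Table n → Table n → Bool
_≤ᵀ_ {zero}  a         b         = not a ∨ b
_≤ᵀ_ {suc n} (a₀ , a₁) (b₀ , b₁) = (a₀ ≤ᵀ b₀) ∧ (a₁ ≤ᵀ b₁)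

monoᵀ : ∀ {n} → Table n → Bool
monoᵀ {zero}  _         = true
monoᵀ {suc n} (t₀ , t₁) = monoᵀ t₀ ∧ (monoᵀ t₁ ∧ (t₀ ≤ᵀ t₁))

dualᵀ : ∀ {n} → Table n → Table n
dualᵀ {zero}  b         = not b
dualᵀ {suc n} (t₀ , t₁) = dualᵀ t₁ , dualᵀ t₀

selfDualᵀ : ∀ {n} → Table n → Bool
selfDualᵀ t = does (dualᵀ t ≟ᵀ t)

-- f ≤ fᵈ says that no set and its complement both satisfy f.
intersecting : ∀ {n} → Table n → Bool
intersecting t = monoᵀ t ∧ (t ≤ᵀ dualᵀ t)

monoᵀ-split : ∀ {n} (t₀ t₁ : Table n) → T (monoᵀ (t₀ , t₁)) →
              T (monoᵀ t₀) × T (monoᵀ t₁) × T (t₀ ≤ᵀ t₁)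
monoᵀ-split t₀ t₁ mono =
  let m₀ , rest = Equivalence.to (𝔹.T-∧ {monoᵀ t₀}) mono
      m₁ , le   = Equivalence.to (𝔹.T-∧ {monoᵀ t₁}) rest
  in m₀ , m₁ , le

≤ᵇ⇒≤ᵀ : ∀ {a b} → a ≤ᵇ b → T (_≤ᵀ_ {0} a b)
≤ᵇ⇒≤ᵀ f≤t         = _
≤ᵇ⇒≤ᵀ {false} b≤b = _
≤ᵇ⇒≤ᵀ {true}  b≤b = _

≤ᵀ-sound : ∀ {n} (a b : Table n) → T (a ≤ᵀ b) → ∀ x → eval a x ≤ᵇ eval b x
≤ᵀ-sound {zero}  false     false     _  [] = b≤b
≤ᵀ-sound {zero}  false     true      _  [] = f≤t
≤ᵀ-sound {zero}  true      true      _  [] = b≤b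
≤ᵀ-sound {suc n} (a₀ , a₁) (b₀ , b₁) le (false ∷ x) = ≤ᵀ-sound a₀ b₀ (T-∧-elimˡ le) x
≤ᵀ-sound {suc n} (a₀ , a₁) (b₀ , b₁) le (true  ∷ x) = ≤ᵀ-sound a₁ b₁ (T-∧-elimʳ le) x

≤ᵀ-complete : ∀ {n} (a b : Table n) → (∀ x → eval a x ≤ᵇ eval b x) → T (a ≤ᵀ b)
≤ᵀ-complete {zero}  a         b         le = ≤ᵇ⇒≤ᵀ (le [])
≤ᵀ-complete {suc n} (a₀ , a₁) (b₀ , b₁) le =
  T-∧-intro (≤ᵀ-complete a₀ b₀ (le ∘ (false ∷_))) (≤ᵀ-complete a₁ b₁ (le ∘ (true ∷_)))

monoᵀ-sound : ∀ {n} (t : Table n) → T (monoᵀ t) → Monotone (eval t)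
monoᵀ-sound {zero}  t         _    []          []          []         = b≤b
monoᵀ-sound {suc n} (t₀ , t₁) mono x y x≤y with monoᵀ-split t₀ t₁ mono
monoᵀ-sound {suc n} (t₀ , t₁) mono (false ∷ x) (false ∷ y) (_ ∷ x≤y) | m₀ , _  , _  =
  monoᵀ-sound t₀ m₀ x y x≤y
monoᵀ-sound {suc n} (t₀ , t₁) mono (true  ∷ x) (true  ∷ y) (_ ∷ x≤y) | _  , m₁ , _  =
  monoᵀ-sound t₁ m₁ x y x≤y
monoᵀ-sound {suc n} (t₀ , t₁) mono (false ∷ x) (true  ∷ y) (_ ∷ x≤y) | m₀ , _  , le =
  𝔹.≤-trans (monoᵀ-sound t₀ m₀ x y x≤y) (≤ᵀ-sound t₀ t₁ le y)

monoᵀ-complete : ∀ {n} (t : Table n) → Monotone (eval t) → T (monoᵀ t)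
monoᵀ-complete {zero}  t         mono = _
monoᵀ-complete {suc n} (t₀ , t₁) mono =
  T-∧-intro (monoᵀ-complete t₀ (λ x y x≤y → mono (false ∷ x) (false ∷ y) (b≤b ∷ x≤y)))
    (T-∧-intro (monoᵀ-complete t₁ (λ x y x≤y → mono (true ∷ x) (true ∷ y) (b≤b ∷ x≤y)))
               (≤ᵀ-complete t₀ t₁ (λ x → mono (false ∷ x) (true ∷ x) (f≤t ∷ ≤ᵢ-refl 𝔹.≤-refl))))

eval-dualᵀ : ∀ {n} (t : Table n) x → eval (dualᵀ t) x ≡ dual (eval t) x
eval-dualᵀ {zero}  t         []          = refl
eval-dualᵀ {suc n} (t₀ , t₁) (false ∷ x) = eval-dualᵀ t₁ x
eval-dualᵀ {suc n} (t₀ , t₁) (true  ∷ x) = eval-dualᵀ t₀ x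

eval-injective : ∀ {n} (a b : Table n) → (∀ x → eval a x ≡ eval b x) → a ≡ b
eval-injective {zero}  a         b         a≗b = a≗b []
eval-injective {suc n} (a₀ , a₁) (b₀ , b₁) a≗b =
  cong₂ _,_ (eval-injective a₀ b₀ (a≗b ∘ (false ∷_))) (eval-injective a₁ b₁ (a≗b ∘ (true ∷_)))

does-monotone? : ∀ {n} (t : Table n) → does (monotone? (eval t)) ≡ monoᵀ t
does-monotone? t = does-≡ (monotone? (eval t)) (monoᵀ-sound t) (monoᵀ-complete t)

does-selfDual? : ∀ {n} (t : Table n) → does (selfDual? (eval t)) ≡ selfDualᵀ t
does-selfDual? t =
  does-≡ (selfDual? (eval t)) (from ∘ does⇒ (dualᵀ t ≟ᵀ t)) (⇒does (dualᵀ t ≟ᵀ t) ∘ to)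
  where
    from : dualᵀ t ≡ t → SelfDual (eval t)
    from t-sd x = trans (cong (λ u → eval u x) (sym t-sd)) (eval-dualᵀ t x)
    to : SelfDual (eval t) → dualᵀ t ≡ t
    to sd = eval-injective (dualᵀ t) t (λ x → trans (eval-dualᵀ t x) (sym (sd x)))

d-even : ∀ n → parity monoᵀ (allTables n) ≡ false → d n % 2 ≡ 0
d-even n even =
  length-filter-%2 (monotone? ∘ eval) (allTables n)
    (trans (parity-cong (allTables n) does-monotone?) even)

λsd-even : ∀ n → parity (λ t → monoᵀ t ∧ selfDualᵀ t) (allTables n) ≡ false → λsd n % 2 ≡ 0
λsd-even n even =
  length-filter-%2 (λ t → monotone? (eval t) ×-dec selfDual? (eval t)) (allTables n)
    (trans (parity-cong (allTables n) (λ t → cong₂ _∧_ (does-monotone? t) (does-selfDual? t))) even)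

dualᵀ-involutive : ∀ {n} → Involutive _≡_ (dualᵀ {n})
dualᵀ-involutive {zero}  b         = 𝔹.not-involutive b
dualᵀ-involutive {suc n} (t₀ , t₁) = cong₂ _,_ (dualᵀ-involutive t₀) (dualᵀ-involutive t₁)

≤ᵀ-dualᵀ : ∀ {n} (a b : Table n) → (dualᵀ b ≤ᵀ dualᵀ a) ≡ (a ≤ᵀ b)
≤ᵀ-dualᵀ {zero}  false     false     = refl
≤ᵀ-dualᵀ {zero}  false     true      = refl
≤ᵀ-dualᵀ {zero}  true      false     = refl
≤ᵀ-dualᵀ {zero}  true      true      = refl
≤ᵀ-dualᵀ {suc n} (a₀ , a₁) (b₀ , b₁) =
  trans (cong₂ _∧_ (≤ᵀ-dualᵀ a₁ b₁) (≤ᵀ-dualᵀ a₀ b₀)) (𝔹.∧-comm (a₁ ≤ᵀ b₁) (a₀ ≤ᵀ b₀))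

monoᵀ-dualᵀ : ∀ {n} (t : Table n) → monoᵀ (dualᵀ t) ≡ monoᵀ t
monoᵀ-dualᵀ {zero}  t         = refl
monoᵀ-dualᵀ {suc n} (t₀ , t₁) =
  trans (cong₂ (λ u v → u ∧ (v ∧ (dualᵀ t₁ ≤ᵀ dualᵀ t₀))) (monoᵀ-dualᵀ t₁) (monoᵀ-dualᵀ t₀))
        (trans (cong (λ u → monoᵀ t₁ ∧ (monoᵀ t₀ ∧ u)) (≤ᵀ-dualᵀ t₀ t₁))
               (x∧yz≡y∧xz (monoᵀ t₁) (monoᵀ t₀) (t₀ ≤ᵀ t₁)))

-- Duality is an involution on monotone functions whose fixed points are the self-dual ones.
parity-monoᵀ≡parity-selfDualᵀ : ∀ n →
  parity monoᵀ (allTables n) ≡ parity (λ t → monoᵀ t ∧ selfDualᵀ t) (allTables n)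
parity-monoᵀ≡parity-selfDualᵀ n =
  parity-involution (allTables-isEnumeration n) dualᵀ dualᵀ-involutive monoᵀ monoᵀ-dualᵀ

-- A self-dual function of n + 1 variables is (f , fᵈ), and it is monotone exactly when f is
-- monotone with f ≤ fᵈ.
parity-selfDualᵀ-suc : ∀ n →
  parity (λ t → monoᵀ t ∧ selfDualᵀ t) (allTables (suc n)) ≡ parity intersecting (allTables n)
parity-selfDualᵀ-suc n = begin
    parity monoSelfDual (allTables (suc n))
  ≡⟨ cong (parity monoSelfDual) (allTables-suc n) ⟩
    parity monoSelfDual (Ts ⋉ λ _ → Ts)
  ≡⟨ parity-⋉ monoSelfDual Ts (λ _ → Ts) ⟩
    parity (λ a → parity (λ b → monoSelfDual (a , b)) Ts) Ts
  ≡⟨ parity-cong Ts (λ a → parity-supported (allTables-isEnumeration n) _ (dualᵀ a) (supp a)) ⟩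
    parity (λ a → monoSelfDual (a , dualᵀ a)) Ts
  ≡⟨ parity-cong Ts value ⟩
    parity intersecting Ts
  ∎
  where
    open ≡-Reasoning
    Ts : List (Table n)
    Ts = allTables n
    monoSelfDual : Table (suc n) → Bool
    monoSelfDual t = monoᵀ t ∧ selfDualᵀ t
    supp : ∀ a b → T (monoᵀ (a , b) ∧ selfDualᵀ (a , b)) → b ≡ dualᵀ a
    supp a b h = sym (×.,-injectiveʳ (does⇒ (dualᵀ (a , b) ≟ᵀ (a , b)) (T-∧-elimʳ h)))
    value : ∀ a → monoᵀ (a , dualᵀ a) ∧ selfDualᵀ (a , dualᵀ a) ≡ intersecting a
    value a = begin
        (monoᵀ a ∧ (monoᵀ (dualᵀ a) ∧ (a ≤ᵀ dualᵀ a))) ∧ selfDualᵀ (a , dualᵀ a)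
      ≡⟨ cong₂ (λ u v → (monoᵀ a ∧ (u ∧ (a ≤ᵀ dualᵀ a))) ∧ v) (monoᵀ-dualᵀ a)
               (dec-true (dualᵀ (a , dualᵀ a) ≟ᵀ (a , dualᵀ a))
                         (cong (_, dualᵀ a) (dualᵀ-involutive a))) ⟩
        (monoᵀ a ∧ (monoᵀ a ∧ (a ≤ᵀ dualᵀ a))) ∧ true
      ≡⟨ 𝔹.∧-identityʳ _ ⟩
        monoᵀ a ∧ (monoᵀ a ∧ (a ≤ᵀ dualᵀ a))
      ≡⟨ ∧-absorbs-repeat (monoᵀ a) _ ⟩
        intersecting a
      ∎

-- Stated for n ≡ suc m and a list equal to allTables m, so that it is applied at the numerals
-- 9 and 8 and at an opaque list: otherwise the type checker unfolds allTables 9 or allTables 8.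
d-λsd-even : ∀ {n m} (tables : List (Table m)) → n ≡ suc m → tables ≡ allTables m →
             parity intersecting tables ≡ false → (d n % 2 ≡ 0) × (λsd n % 2 ≡ 0)
d-λsd-even {m = m} _ refl refl even =
  d-even (suc m) (trans (parity-monoᵀ≡parity-selfDualᵀ (suc m)) λ-even) , λsd-even (suc m) λ-even
  where
    λ-even : parity (λ t → monoᵀ t ∧ selfDualᵀ t) (allTables (suc m)) ≡ false
    λ-even = trans (parity-selfDualᵀ-suc m) even

-- Permutations of the variables

record IsAutomorphism {n} (ι : Table n → Table n) : Set where
  field
    monoᵀ-ι : ∀ t → monoᵀ (ι t) ≡ monoᵀ t
    ≤ᵀ-ι    : ∀ a b → (ι a ≤ᵀ ι b) ≡ (a ≤ᵀ b)
    dualᵀ-ι : ∀ t → dualᵀ (ι t) ≡ ι (dualᵀ t)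

intersecting-ι : ∀ {n} (ι : Table n → Table n) → IsAutomorphism ι →
                 ∀ t → intersecting (ι t) ≡ intersecting t
intersecting-ι ι S t =
  cong₂ _∧_ (monoᵀ-ι t) (trans (cong (ι t ≤ᵀ_) (dualᵀ-ι t)) (≤ᵀ-ι t (dualᵀ t)))
  where open IsAutomorphism S

∘-isAutomorphism : ∀ {n} {f g : Table n → Table n} →
                   IsAutomorphism f → IsAutomorphism g → IsAutomorphism (f ∘ g)
∘-isAutomorphism {f = f} {g} Sf Sg = record
  { monoᵀ-ι = λ t → trans (monoᵀ-ι Sf (g t)) (monoᵀ-ι Sg t)
  ; ≤ᵀ-ι    = λ a b → trans (≤ᵀ-ι Sf (g a) (g b)) (≤ᵀ-ι Sg a b)
  ; dualᵀ-ι = λ t → trans (dualᵀ-ι Sf (g t)) (cong f (dualᵀ-ι Sg t))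
  }
  where open IsAutomorphism

swap₁₂ : Table (2 + m) → Table (2 + m)
swap₁₂ ((t₀₀ , t₀₁) , (t₁₀ , t₁₁)) = (t₀₀ , t₁₀) , (t₀₁ , t₁₁)

atDepth : ∀ k → (Table m → Table m) → Table (k + m) → Table (k + m)
atDepth zero    g t         = g t
atDepth (suc k) g (t₀ , t₁) = atDepth k g t₀ , atDepth k g t₁

swap₁₂-isAutomorphism : IsAutomorphism (swap₁₂ {m})
swap₁₂-isAutomorphism = record { monoᵀ-ι = monoᵀ-swap₁₂ ; ≤ᵀ-ι = ≤ᵀ-swap₁₂ ; dualᵀ-ι = λ _ → refl }
  where
    open import Algebra.Solver.CommutativeMonoid 𝔹.∧-commutativeMonoid using (prove; var; _⊕_)
    monoᵀ-swap₁₂ : ∀ t → monoᵀ (swap₁₂ t) ≡ monoᵀ t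
    monoᵀ-swap₁₂ ((p , q) , (r , s)) =
      prove 8 ((mp ⊕ (mr ⊕ p≤r)) ⊕ ((mq ⊕ (ms ⊕ q≤s)) ⊕ (p≤q ⊕ r≤s)))
              ((mp ⊕ (mq ⊕ p≤q)) ⊕ ((mr ⊕ (ms ⊕ r≤s)) ⊕ (p≤r ⊕ q≤s)))
              ( monoᵀ p ∷ monoᵀ q ∷ monoᵀ r ∷ monoᵀ s
              ∷ (p ≤ᵀ q) ∷ (r ≤ᵀ s) ∷ (p ≤ᵀ r) ∷ (q ≤ᵀ s) ∷ [])
      where
        mp = var (# 0); mq = var (# 1); mr = var (# 2); ms = var (# 3)
        p≤q = var (# 4); r≤s = var (# 5); p≤r = var (# 6); q≤s = var (# 7)
    ≤ᵀ-swap₁₂ : ∀ a b → (swap₁₂ a ≤ᵀ swap₁₂ b) ≡ (a ≤ᵀ b)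
    ≤ᵀ-swap₁₂ ((p , q) , (r , s)) ((p′ , q′) , (r′ , s′)) =
      ∧-interchange (p ≤ᵀ p′) (r ≤ᵀ r′) (q ≤ᵀ q′) (s ≤ᵀ s′)

atDepth-isAutomorphism : ∀ k {g : Table m → Table m} →
                         IsAutomorphism g → IsAutomorphism (atDepth k g)
atDepth-isAutomorphism zero    S = S
atDepth-isAutomorphism (suc k) S = record
  { monoᵀ-ι = λ { (t₀ , t₁) → cong₂ _∧_ (monoᵀ-ι t₀) (cong₂ _∧_ (monoᵀ-ι t₁) (≤ᵀ-ι t₀ t₁)) }
  ; ≤ᵀ-ι    = λ { (a₀ , a₁) (b₀ , b₁) → cong₂ _∧_ (≤ᵀ-ι a₀ b₀) (≤ᵀ-ι a₁ b₁) }
  ; dualᵀ-ι = λ { (t₀ , t₁) → cong₂ _,_ (dualᵀ-ι t₁) (dualᵀ-ι t₀) }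
  }
  where open IsAutomorphism (atDepth-isAutomorphism k S)

atDepth-involutive : ∀ k {g : Table m → Table m} → Involutive _≡_ g → Involutive _≡_ (atDepth k g)
atDepth-involutive zero    g-invol t         = g-invol t
atDepth-involutive (suc k) g-invol (t₀ , t₁) =
  cong₂ _,_ (atDepth-involutive k g-invol t₀) (atDepth-involutive k g-invol t₁)

atDepth-square : ∀ k {f g f′ g′ : Table m → Table m} → (∀ t → f (g t) ≡ g′ (f′ t)) →
                 ∀ t → atDepth k f (atDepth k g t) ≡ atDepth k g′ (atDepth k f′ t)
atDepth-square zero    square t         = square t
atDepth-square (suc k) square (t₀ , t₁) =
  cong₂ _,_ (atDepth-square k square t₀) (atDepth-square k square t₁)

-- The transposition of variable pairs (1 3)(2 4) = (2 3)(1 2)(3 4)(2 3).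
swapPairs : Table (4 + m) → Table (4 + m)
swapPairs = atDepth 1 swap₁₂ ∘ swap₁₂ ∘ atDepth 2 swap₁₂ ∘ atDepth 1 swap₁₂

swapPairs-isAutomorphism : IsAutomorphism (swapPairs {m})
swapPairs-isAutomorphism =
  ∘-isAutomorphism (atDepth-isAutomorphism 1 swap₁₂-isAutomorphism)
    (∘-isAutomorphism swap₁₂-isAutomorphism
      (∘-isAutomorphism (atDepth-isAutomorphism 2 swap₁₂-isAutomorphism)
                        (atDepth-isAutomorphism 1 swap₁₂-isAutomorphism)))

swap₁₂-swapPairs-isD4 : IsD4 (swap₁₂ {2 + m}) (atDepth 2 swap₁₂) swapPairs
swap₁₂-swapPairs-isD4 = record
  { σ₁-involutive = λ _ → refl
  ; σ₂-involutive = λ _ → refl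
  ; β-involutive  = λ _ → refl
  ; σ₁σ₂≡σ₂σ₁     = λ _ → refl
  ; σ₁β≡βσ₂       = λ _ → refl
  ; σ₂β≡βσ₁       = λ _ → refl
  }

atDepth-isD4 : ∀ k {σ₁ σ₂ β : Table m → Table m} → IsD4 σ₁ σ₂ β →
               IsD4 (atDepth k σ₁) (atDepth k σ₂) (atDepth k β)
atDepth-isD4 k D = record
  { σ₁-involutive = atDepth-involutive k σ₁-involutive
  ; σ₂-involutive = atDepth-involutive k σ₂-involutive
  ; β-involutive  = atDepth-involutive k β-involutive
  ; σ₁σ₂≡σ₂σ₁     = atDepth-square k σ₁σ₂≡σ₂σ₁
  ; σ₁β≡βσ₂       = atDepth-square k σ₁β≡βσ₂
  ; σ₂β≡βσ₁       = atDepth-square k σ₂β≡βσ₁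
  }
  where open IsD4 D

sub : ∀ k → Table (k + m) → Input k → Table m
sub zero    t         []          = t
sub (suc k) (t₀ , t₁) (false ∷ x) = sub k t₀ x
sub (suc k) (t₀ , t₁) (true  ∷ x) = sub k t₁ x

eval-sub : ∀ k (t : Table (k + m)) x y → eval (sub k t x) y ≡ eval t (x ++ᵛ y)
eval-sub zero    t         []          y = refl
eval-sub (suc k) (t₀ , t₁) (false ∷ x) y = eval-sub k t₀ x y
eval-sub (suc k) (t₀ , t₁) (true  ∷ x) y = eval-sub k t₁ x y

sub-atDepth : ∀ k (g : Table m → Table m) t x → sub k (atDepth k g t) x ≡ g (sub k t x)
sub-atDepth zero    g t         []          = refl
sub-atDepth (suc k) g (t₀ , t₁) (false ∷ x) = sub-atDepth k g t₀ x
sub-atDepth (suc k) g (t₀ , t₁) (true  ∷ x) = sub-atDepth k g t₁ x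

monoᵀ-sub-≤ : ∀ k (t : Table (k + m)) → T (monoᵀ t) → ∀ x x′ → x ≤ᵢ x′ → T (sub k t x ≤ᵀ sub k t x′)
monoᵀ-sub-≤ k t mono x x′ x≤x′ = ≤ᵀ-complete (sub k t x) (sub k t x′) λ y →
  subst₂ _≤ᵇ_ (sym (eval-sub k t x y)) (sym (eval-sub k t x′ y))
         (monoᵀ-sound t mono (x ++ᵛ y) (x′ ++ᵛ y) (++⁺ x≤x′ (≤ᵢ-refl 𝔹.≤-refl)))

monoᵀ-sub : ∀ k (t : Table (k + m)) → T (monoᵀ t) → ∀ x → T (monoᵀ (sub k t x))
monoᵀ-sub k t mono x = monoᵀ-complete (sub k t x) λ y y′ y≤y′ →
  subst₂ _≤ᵇ_ (sym (eval-sub k t x y)) (sym (eval-sub k t x y′))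
         (monoᵀ-sound t mono (x ++ᵛ y) (x ++ᵛ y′) (++⁺ (≤ᵢ-refl 𝔹.≤-refl) y≤y′))

fixedBy₃-sub : ∀ k (σ₁ σ₂ β : Table m → Table m) t x →
  T (fixedBy₃ _≟ᵀ_ (atDepth k σ₁) (atDepth k σ₂) (atDepth k β) t) →
  T (fixedBy₃ _≟ᵀ_ σ₁ σ₂ β (sub k t x))
fixedBy₃-sub k σ₁ σ₂ β t x fixed =
  let σ₁-fixed , σ₂-fixed , β-fixed =
        fixedBy₃⇒ _≟ᵀ_ (atDepth k σ₁) (atDepth k σ₂) (atDepth k β) t fixed
  in ⇒fixedBy₃ _≟ᵀ_ σ₁ σ₂ β (sub k t x) (at σ₁ σ₁-fixed) (at σ₂ σ₂-fixed) (at β β-fixed)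
  where
    at : (g : Table _ → Table _) → atDepth k g t ≡ t → g (sub k t x) ≡ sub k t x
    at g g-fixed = trans (sym (sub-atDepth k g t x)) (cong (λ u → sub k u x) g-fixed)

-- Tables constant on the orbits of ⟨(1 2), (3 4), (1 3)(2 4)⟩

Orbits : Set → Set
Orbits X = X × X × X × X × X × X

-- Representatives of the six orbits on {0,1}⁴: 0000, weight one, {0011, 1100},
-- {0101, 0110, 1001, 1010}, weight three and 1111.
o₀ o₁ o₂ o₃ o₄ o₅ : Input 4
o₀ = false ∷ false ∷ false ∷ false ∷ []
o₁ = false ∷ false ∷ false ∷ true  ∷ []
o₂ = false ∷ false ∷ true  ∷ true  ∷ []
o₃ = false ∷ true  ∷ false ∷ true  ∷ []
o₄ = false ∷ true  ∷ true  ∷ true  ∷ []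
o₅ = true  ∷ true  ∷ true  ∷ true  ∷ []

o₀≤o₁ : o₀ ≤ᵢ o₁
o₀≤o₁ = b≤b ∷ b≤b ∷ b≤b ∷ f≤t ∷ []

o₁≤o₂ : o₁ ≤ᵢ o₂
o₁≤o₂ = b≤b ∷ b≤b ∷ f≤t ∷ b≤b ∷ []

o₁≤o₃ : o₁ ≤ᵢ o₃
o₁≤o₃ = b≤b ∷ f≤t ∷ b≤b ∷ b≤b ∷ []

o₂≤o₄ : o₂ ≤ᵢ o₄
o₂≤o₄ = b≤b ∷ f≤t ∷ b≤b ∷ b≤b ∷ []

o₃≤o₄ : o₃ ≤ᵢ o₄
o₃≤o₄ = b≤b ∷ b≤b ∷ f≤t ∷ b≤b ∷ []

o₄≤o₅ : o₄ ≤ᵢ o₅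
o₄≤o₅ = f≤t ∷ b≤b ∷ b≤b ∷ b≤b ∷ []

topInvariant : Table (4 + m) → Bool
topInvariant = fixedBy₃ _≟ᵀ_ swap₁₂ (atDepth 2 swap₁₂) swapPairs

orbitTable : Orbits (Table m) → Table (4 + m)
orbitTable (g₀ , g₁ , g₂ , g₃ , g₄ , g₅) =
  (((g₀ , g₁) , (g₁ , g₂)) , ((g₁ , g₃) , (g₃ , g₄))) ,
  (((g₁ , g₃) , (g₃ , g₄)) , ((g₂ , g₄) , (g₄ , g₅)))

orbitValues : Table (4 + m) → Orbits (Table m)
orbitValues t = sub 4 t o₀ , sub 4 t o₁ , sub 4 t o₂ , sub 4 t o₃ , sub 4 t o₄ , sub 4 t o₅

orbitValues-orbitTable : (w : Orbits (Table m)) → orbitValues (orbitTable w) ≡ w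
orbitValues-orbitTable w = refl

topInvariant⇒orbitTable : (t : Table (4 + m)) → T (topInvariant t) → t ≡ orbitTable (orbitValues t)
topInvariant⇒orbitTable t fixed =
  let σ₁-fixed , σ₂-fixed , β-fixed = fixedBy₃⇒ _≟ᵀ_ swap₁₂ (atDepth 2 swap₁₂) swapPairs t fixed
  in orbitTable-fixed t σ₁-fixed σ₂-fixed β-fixed
  where
    orbitTable-fixed : ∀ t → swap₁₂ t ≡ t → atDepth 2 swap₁₂ t ≡ t → swapPairs t ≡ t →
                       t ≡ orbitTable (orbitValues t)
    orbitTable-fixed ((((t₀ , t₁) , (t₂ , t₃)) , ((t₄ , t₅) , (t₆ , t₇))) ,
                      (((t₈ , t₉) , (t₁₀ , t₁₁)) , ((t₁₂ , t₁₃) , (t₁₄ , t₁₅))))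
                     refl refl refl = refl

-- Intersecting functions of eight variables

invariantMono : Table 4 → Bool
invariantMono g = monoᵀ g ∧ topInvariant g

invariantMonoTables : List (Table 4)
invariantMonoTables = map orbitTable
  ( (false , false , false , false , false , false)
  ∷ (false , false , false , false , false , true)
  ∷ (false , false , false , false , true  , true)
  ∷ (false , false , false , true  , true  , true)
  ∷ (false , false , true  , false , true  , true)
  ∷ (false , false , true  , true  , true  , true)
  ∷ (false , true  , true  , true  , true  , true)
  ∷ (true  , true  , true  , true  , true  , true)
  ∷ [])

filterᵇ-invariantMono : filterᵇ invariantMono (allTables 4) ≡ invariantMonoTables
filterᵇ-invariantMono = refl

filterᵇ-invariantMono-∧ : ∀ c →
  filterᵇ (λ g → invariantMono g ∧ c g) (allTables 4) ≡ filterᵇ c invariantMonoTables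
filterᵇ-invariantMono-∧ c =
  trans (filterᵇ-∧ invariantMono c (allTables 4)) (cong (filterᵇ c) filterᵇ-invariantMono)

topInvariant-atDepth : (h : Table 4 → Table 4) → Involutive _≡_ h →
                    ∀ t → topInvariant {4} (atDepth 4 h t) ≡ topInvariant t
topInvariant-atDepth h h-invol t =
  cong₂ _∧_ (cong₂ _∧_ (commutes swap₁₂ (λ _ → refl)) (commutes (atDepth 2 swap₁₂) (λ _ → refl)))
            (commutes swapPairs (λ _ → refl))
  where
    commutes : (j : Table 8 → Table 8) → (∀ t → j (atDepth 4 h t) ≡ atDepth 4 h (j t)) →
               fixedBy _≟ᵀ_ j (atDepth 4 h t) ≡ fixedBy _≟ᵀ_ j t
    commutes j j∘h =
      fixedBy-conjugate _≟ᵀ_ j (atDepth 4 h) j (atDepth-involutive 4 {g = h} h-invol) j∘h t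


-- Opaque, so that the conversion checker never unfolds the 2²⁵⁶ tables of eight variables.
opaque
  tables₈ : List (Table 8)
  tables₈ = allTables 8

  tables₈≡allTables : tables₈ ≡ allTables 8
  tables₈≡allTables = refl

tables₈-isEnumeration : IsEnumeration _≟ᵀ_ tables₈
tables₈-isEnumeration =
  subst (IsEnumeration _≟ᵀ_) (sym tables₈≡allTables) (allTables-isEnumeration 8)

bottomInvariant : Table 8 → Bool
bottomInvariant =
  fixedBy₃ _≟ᵀ_ (atDepth 4 swap₁₂) (atDepth 4 (atDepth 2 swap₁₂)) (atDepth 4 swapPairs)

intersectingInvariant : Table 8 → Bool
intersectingInvariant t = (intersecting t ∧ topInvariant t) ∧ bottomInvariant t

parity-intersecting-invariant : parity intersecting tables₈ ≡ parity intersectingInvariant tables₈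
parity-intersecting-invariant =
  trans (parity-D4-fixed (tables₈-isEnumeration) swap₁₂-swapPairs-isD4 intersecting
           (intersecting-ι swap₁₂ swap₁₂-isAutomorphism)
           (intersecting-ι (atDepth 2 swap₁₂) (atDepth-isAutomorphism 2 swap₁₂-isAutomorphism))
           (intersecting-ι swapPairs swapPairs-isAutomorphism))
        (parity-D4-fixed (tables₈-isEnumeration) (atDepth-isD4 4 swap₁₂-swapPairs-isD4)
           (λ t → intersecting t ∧ topInvariant t)
           (invariant swap₁₂ swap₁₂-isAutomorphism (λ _ → refl))
           (invariant (atDepth 2 swap₁₂) (atDepth-isAutomorphism 2 swap₁₂-isAutomorphism)
                      (λ _ → refl))
           (invariant swapPairs swapPairs-isAutomorphism (λ _ → refl)))
  where
    invariant : (h : Table 4 → Table 4) → IsAutomorphism h → Involutive _≡_ h →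
                ∀ t → intersecting (atDepth 4 h t) ∧ topInvariant (atDepth 4 h t) ≡
                      intersecting t ∧ topInvariant t
    invariant h S h-invol t =
      cong₂ _∧_ (intersecting-ι (atDepth 4 h) (atDepth-isAutomorphism 4 S) t)
                (topInvariant-atDepth h h-invol t)

intersectingInvariant⇒ : ∀ t → T (intersectingInvariant t) →
                         T (monoᵀ t) × T (topInvariant t) × T (bottomInvariant t)
intersectingInvariant⇒ t h =
  let int-top , bottom = Equivalence.to (𝔹.T-∧ {intersecting t ∧ topInvariant t}) h
      int     , top    = Equivalence.to (𝔹.T-∧ {intersecting t}) int-top
  in Equivalence.to (𝔹.T-∧ {monoᵀ t}) int .proj₁ , top , bottom

orbitIntersecting : Orbits (Table 4) → Bool
orbitIntersecting w = intersectingInvariant (orbitTable w)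

orbitList : List (Orbits (Table 4))
orbitList = allTables 4 ⋉ λ _ → allTables 4 ⋉ λ _ → allTables 4 ⋉ λ _ →
            allTables 4 ⋉ λ _ → allTables 4 ⋉ λ _ → allTables 4

_≟ₒ_ : DecidableEquality (Orbits (Table 4))
_≟ₒ_ = ×.≡-dec _≟ᵀ_ (×.≡-dec _≟ᵀ_ (×.≡-dec _≟ᵀ_ (×.≡-dec _≟ᵀ_ (×.≡-dec _≟ᵀ_ _≟ᵀ_))))

orbitList-isEnumeration : IsEnumeration _≟ₒ_ orbitList
orbitList-isEnumeration = ×-isEnumeration A₄ (×-isEnumeration A₄ (×-isEnumeration A₄
                          (×-isEnumeration A₄ (×-isEnumeration A₄ A₄))))
  where
    A₄ : IsEnumeration _≟ᵀ_ (allTables 4)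
    A₄ = allTables-isEnumeration 4

parity-orbits : parity intersectingInvariant tables₈ ≡ parity orbitIntersecting orbitList
parity-orbits =
  parity-section tables₈-isEnumeration orbitList-isEnumeration (orbitTable {4}) (orbitValues {4})
    orbitValues-orbitTable intersectingInvariant
    (λ t h → topInvariant⇒orbitTable t (intersectingInvariant⇒ t h .proj₂ .proj₁))

-- The orbit values of a monotone table satisfy g₀ ≤ g₁ ≤ g₂ ≤ g₄ ≤ g₅ and g₁ ≤ g₃ ≤ g₄.
admissibleOrbits : List (Orbits (Table 4))
admissibleOrbits =
  invariantMonoTables ⋉ λ g₀ →
  filterᵇ (g₀ ≤ᵀ_) invariantMonoTables ⋉ λ g₁ →
  filterᵇ (g₁ ≤ᵀ_) invariantMonoTables ⋉ λ g₂ →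
  filterᵇ (g₁ ≤ᵀ_) invariantMonoTables ⋉ λ g₃ →
  filterᵇ (λ g → (g₂ ≤ᵀ g) ∧ (g₃ ≤ᵀ g)) invariantMonoTables ⋉ λ g₄ →
  filterᵇ (g₄ ≤ᵀ_) invariantMonoTables

module _ (w : Orbits (Table 4)) (h : T (orbitIntersecting w)) where
  private
    t : Table 8
    t = orbitTable w
    mono : T (monoᵀ t)
    mono = intersectingInvariant⇒ t h .proj₁
    bottom : T (bottomInvariant t)
    bottom = intersectingInvariant⇒ t h .proj₂ .proj₂

  orbit-invariantMono : ∀ x → T (invariantMono (sub 4 t x))
  orbit-invariantMono x =
    T-∧-intro (monoᵀ-sub 4 t mono x) (fixedBy₃-sub 4 swap₁₂ (atDepth 2 swap₁₂) swapPairs t x bottom)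

  orbit-≤ : ∀ x x′ → x ≤ᵢ x′ → T (sub 4 t x ≤ᵀ sub 4 t x′)
  orbit-≤ = monoᵀ-sub-≤ 4 t mono

  orbit-invariantMono-≤ : ∀ x x′ → x ≤ᵢ x′ →
                          T (invariantMono (sub 4 t x′) ∧ (sub 4 t x ≤ᵀ sub 4 t x′))
  orbit-invariantMono-≤ x x′ x≤x′ = T-∧-intro (orbit-invariantMono x′) (orbit-≤ x x′ x≤x′)

parity-admissible : parity orbitIntersecting orbitList ≡
                    parity orbitIntersecting admissibleOrbits
parity-admissible =
  parity-⋉-restrict _ _ filterᵇ-invariantMono (λ g₀ r h → orbit-invariantMono (g₀ , r) h o₀) λ g₀ →
  parity-⋉-restrict _ _ (filterᵇ-invariantMono-∧ (g₀ ≤ᵀ_))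
    (λ g₁ r h → orbit-invariantMono-≤ (g₀ , g₁ , r) h o₀ o₁ o₀≤o₁) λ g₁ →
  parity-⋉-restrict _ _ (filterᵇ-invariantMono-∧ (g₁ ≤ᵀ_))
    (λ g₂ r h → orbit-invariantMono-≤ (g₀ , g₁ , g₂ , r) h o₁ o₂ o₁≤o₂) λ g₂ →
  parity-⋉-restrict _ _ (filterᵇ-invariantMono-∧ (g₁ ≤ᵀ_))
    (λ g₃ r h → orbit-invariantMono-≤ (g₀ , g₁ , g₂ , g₃ , r) h o₁ o₃ o₁≤o₃) λ g₃ →
  parity-⋉-restrict _ _ (filterᵇ-invariantMono-∧ (λ g → (g₂ ≤ᵀ g) ∧ (g₃ ≤ᵀ g)))
    (λ g₄ r h → let w = g₀ , g₁ , g₂ , g₃ , g₄ , r in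
      T-∧-intro (orbit-invariantMono w h o₄)
                (T-∧-intro (orbit-≤ w h o₂ o₄ o₂≤o₄)
                           (orbit-≤ w h o₃ o₄ o₃≤o₄))) λ g₄ →
  parity-restrict _ _ (allTables 4) (filterᵇ-invariantMono-∧ (g₄ ≤ᵀ_))
    (λ g₅ h → orbit-invariantMono-≤ (g₀ , g₁ , g₂ , g₃ , g₄ , g₅) h o₄ o₅ o₄≤o₅)

opaque
  unfolding _⋉_
  parity-admissibleOrbits : parity orbitIntersecting admissibleOrbits ≡ false
  parity-admissibleOrbits = refl

parity-intersecting₈ : parity intersecting tables₈ ≡ false
parity-intersecting₈ = begin
    parity intersecting tables₈
  ≡⟨ parity-intersecting-invariant ⟩
    parity intersectingInvariant tables₈
  ≡⟨ parity-orbits ⟩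
    parity orbitIntersecting orbitList
  ≡⟨ parity-admissible ⟩
    parity orbitIntersecting admissibleOrbits
  ≡⟨ parity-admissibleOrbits ⟩
    false
  ∎
  where open ≡-Reasoning

corollary2 : (d 9 % 2 ≡ 0) × (λsd 9 % 2 ≡ 0)
corollary2 = d-λsd-even {9} {8} tables₈ refl tables₈≡allTables parity-intersecting₈
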